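{- Let $\Gamma=(X,\ast,t)$ be a pregeometry with type set $I$ all of whose rank 2 truncations are connected, and let $G\leq\operatorname{Aut}\Gamma$ be transitive on each $X_i$. Suppose $\Gamma$ is fully $G$-primitive. If $\Gamma$ is indecomposable, then $\Gamma$ is fully $G$-faithful.
   Context: A pregeometry $\Gamma=(X,\ast,t)$: finite set $X$, symmetric reflexive incidence $\ast$, surjection $t:X\to I$ onto types, with distinct incident elements of distinct types; $X_i=t^{ -1}(i)$. The $J$-truncation ($\emptyset\neq J\subseteq I$) has elements $t^{ -1}(J)$ with restricted incidence and types. The incidence graph has vertex set $X$ and edges between incident elements of distinct types; rank 2 truncations connected means for all distinct $i,j$ the incidence graph of the $\{i,j\}$-truncation is connected. Automorphisms preserve types and incidence. $\Gamma$ is fully $G$-primitive if $G^{X_i}$ is primitive for each $i\in I$, and fully $G$-faithful if $G$ acts faithfully on each $X_i$. Direct sum $\Gamma_1\oplus\Gamma_2$: disjoint union of two pregeometries with disjoint type sets, with every element of $\Gamma_1$ incident with every element of $\Gamma_2$. $\Gamma$ is decomposable if its type set can be partitioned into two nonempty parts $I_1,I_2$ such that every element of type in $I_1$ is incident with every element of type in $I_2$ (i.e. $\Gamma=\Gamma_{I_1}\oplus\Gamma_{I_2}$), and indecomposable otherwise. -}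

module Defs where

open import Data.Nat using (ℕ; _≤_)
open import Data.Fin using (Fin)
open import Data.Fin.Subset using (Subset; _∈_; _∉_; ∣_∣)
open import Data.Fin.Permutation using (Permutation′; _⟨$⟩ʳ_; _⟨$⟩ˡ_; id; flip; _∘ₚ_; _≈_)
open import Data.Product using (Σ; ∃; _×_; _,_)
open import Data.Sum using (_⊎_)
open import Relation.Nullary using (¬_; Dec)
open import Relation.Binary.PropositionalEquality using (_≡_; _≢_)
open import Function.Bundles using (_⇔_)

-- A (finite) pregeometry with element set X = Fin n and type set I = Fin k.
record Pregeometry (n k : ℕ) : Set₁ where
  field
    _*_       : Fin n → Fin n → Set
    *-dec     : ∀ x y → Dec (x * y)
    *-refl    : ∀ x → x * x
    *-sym     : ∀ {x y} → x * y → y * x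
    typ       : Fin n → Fin k
    typ-surj  : ∀ (i : Fin k) → ∃ λ x → typ x ≡ i
    *-typ     : ∀ {x y} → x * y → x ≢ y → typ x ≢ typ y

module _ {n k : ℕ} (Γ : Pregeometry n k) where
  open Pregeometry Γ

  -- Walks in the incidence graph of the J-truncation (J a set of types):
  -- all vertices have type in J; consecutive vertices are incident and of distinct types.
  data Walk (J : Fin k → Set) : Fin n → Fin n → Set where
    [] : ∀ {x} → J (typ x) → Walk J x x
    _∷_ : ∀ {x y z} → J (typ x) → (x * y) × (typ x ≢ typ y) → Walk J y z → Walk J x z

  Pair : Fin k → Fin k → Fin k → Set
  Pair i j l = (l ≡ i) ⊎ (l ≡ j)

  Rank2Connected : Set
  Rank2Connected = ∀ (i j : Fin k) → i ≢ j →
    ∀ x y → Pair i j (typ x) → Pair i j (typ y) → Walk (Pair i j) x y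

  IsAut : Permutation′ n → Set
  IsAut g = (∀ x → typ (g ⟨$⟩ʳ x) ≡ typ x)
          × (∀ x y → (x * y) ⇔ ((g ⟨$⟩ʳ x) * (g ⟨$⟩ʳ y)))

  record SubgroupOfAut (G : Permutation′ n → Set) : Set where
    field
      resp-≈  : ∀ {g h} → g ≈ h → G g → G h
      has-id  : G id
      has-∘   : ∀ {g h} → G g → G h → G (g ∘ₚ h)
      has-inv : ∀ {g} → G g → G (flip g)
      aut     : ∀ {g} → G g → IsAut g

  module _ (G : Permutation′ n → Set) where

    TransitiveOn : Fin k → Set
    TransitiveOn i = ∀ x y → typ x ≡ i → typ y ≡ i →
      Σ (Permutation′ n) λ g → G g × (g ⟨$⟩ʳ x ≡ y)

    -- B ⊆ X_i is a block for G: for each g ∈ G, either gB = B or gB ∩ B = ∅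
    -- (for finite B, gB ⊆ B is equivalent to gB = B).
    IsBlock : Fin k → Subset n → Set
    IsBlock i B = (∀ x → x ∈ B → typ x ≡ i)
      × (∀ g → G g → (∀ x → x ∈ B → g ⟨$⟩ʳ x ∈ B) ⊎ (∀ x → x ∈ B → g ⟨$⟩ʳ x ∉ B))

    TrivialBlock : Fin k → Subset n → Set
    TrivialBlock i B = (∣ B ∣ ≤ 1) ⊎ (∀ x → typ x ≡ i → x ∈ B)

    PrimitiveOn : Fin k → Set
    PrimitiveOn i = TransitiveOn i × (∀ B → IsBlock i B → TrivialBlock i B)

    FullyPrimitive : Set
    FullyPrimitive = ∀ i → PrimitiveOn i

    FaithfulOn : Fin k → Set
    FaithfulOn i = ∀ g → G g → (∀ x → typ x ≡ i → g ⟨$⟩ʳ x ≡ x) → ∀ x → g ⟨$⟩ʳ x ≡ x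

    FullyFaithful : Set
    FullyFaithful = ∀ i → FaithfulOn i

  Decomposable : Set
  Decomposable = Σ (Subset k) λ I₁ →
    (∃ λ i → i ∈ I₁) × (∃ λ j → j ∉ I₁) ×
    (∀ x y → typ x ∈ I₁ → typ y ∉ I₁ → x * y)

  Indecomposable : Set
  Indecomposable = ¬ Decomposable

-- The kernel K of G on X_i is normal in G, so on every X_l its orbits form a system of
-- blocks; by primitivity K acts on each X_l either trivially or transitively. If K ≠ 1,
-- the types on which K acts trivially (among them i) and the others split I into two
-- nonempty parts. An element x of the first kind is incident with some w of any other
-- type j (rank 2 connectedness); if K is transitive on X_j, then applying K, which fixes
-- x, makes x incident with all of X_j. So Γ decomposes.
module Submission where

open import Defs
open import Level using (Level)
open import Data.Nat using (ℕ; zero; suc; _<_)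
open import Data.Nat.Properties using (<⇒≱)
open import Data.Fin using (Fin; zero; suc)
open import Data.Fin.Properties using (_≟_)
open import Data.Fin.Permutation using (Permutation′; _⟨$⟩ʳ_; _⟨$⟩ˡ_; id; flip; _∘ₚ_; inverseˡ; inverseʳ)
open import Data.Fin.Subset using (Subset; _∈_; _∉_; ∣_∣)
open import Data.Fin.Subset.Properties using (∣⁅x⁆∣≡1; p⊂q⇒∣p∣<∣q∣; x∈⁅y⁆⇒x≡y; x≢y⇒x∉⁅y⁆)
open import Data.Vec using (tabulate)
open import Data.Vec.Properties using ([]=⇒lookup; lookup⇒[]=; lookup∘tabulate)
open import Data.Product using (Σ; ∃; _×_; _,_; proj₁; proj₂)
open import Data.Sum using (_⊎_; inj₁; inj₂)
open import Data.Empty using (⊥-elim)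
open import Function using (_∘_)
open import Function.Bundles using (Equivalence)
open import Relation.Unary using (Pred; Decidable)
open import Relation.Nullary using (¬_; yes; no; does; ¬?)
open import Relation.Nullary.Decidable using (dec-true; decidable-stable; ¬¬-excluded-middle)
open import Relation.Nullary.Negation using (¬¬-map)
open import Relation.Binary.PropositionalEquality using (_≡_; _≢_; refl; sym; trans; cong; subst; subst₂)

private
  variable
    ℓ : Level
    m : ℕ

-- Orbits of an arbitrary predicate K on permutations need not be decidable; since every
-- goal below is decidable, it suffices to have their decidability under double negation.
¬¬-decidable : (P : Pred (Fin m) ℓ) → ¬ ¬ Decidable P
¬¬-decidable {m = zero}  P ¬P? = ¬P? λ ()
¬¬-decidable {m = suc m} P ¬P? = ¬¬-excluded-middle λ P0? →
  ¬¬-decidable (P ∘ suc) λ Psuc? → ¬P? λ { zero → P0? ; (suc x) → Psuc? x }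

toSubset : {P : Pred (Fin m) ℓ} → Decidable P → Subset m
toSubset P? = tabulate (does ∘ P?)

module _ {P : Pred (Fin m) ℓ} (P? : Decidable P) where

  ∈-toSubset⁺ : ∀ {x} → P x → x ∈ toSubset P?
  ∈-toSubset⁺ {x} px = lookup⇒[]= x _ (trans (lookup∘tabulate _ x) (dec-true (P? x) px))

  ∈-toSubset⁻ : ∀ {x} → x ∈ toSubset P? → P x
  ∈-toSubset⁻ {x} x∈ with P? x | trans (sym (lookup∘tabulate (does ∘ P?) x)) ([]=⇒lookup x∈)
  ... | yes px | _  = px
  ... | no  _  | ()

x≢y⇒1<∣p∣ : ∀ {x y} {p : Subset m} → x ∈ p → y ∈ p → x ≢ y → 1 < ∣ p ∣
x≢y⇒1<∣p∣ {x = x} {y} {p} x∈p y∈p x≢y = subst (_< ∣ p ∣) (∣⁅x⁆∣≡1 x)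
  (p⊂q⇒∣p∣<∣q∣ ((λ z∈⁅x⁆ → subst (_∈ p) (sym (x∈⁅y⁆⇒x≡y x z∈⁅x⁆)) x∈p)
               , y , y∈p , x≢y⇒x∉⁅y⁆ (x≢y ∘ sym)))

module _ {n k : ℕ} (Γ : Pregeometry n k) where
  open Pregeometry Γ

  walk-head : ∀ {J : Fin k → Set} {x y} → Walk Γ J x y → J (typ x)
  walk-head ([] Jx)      = Jx
  walk-head (_∷_ Jx _ _) = Jx

  neighbour-of-type : Rank2Connected Γ → ∀ x y → typ x ≢ typ y →
                      ∃ λ w → x * w × typ w ≡ typ y
  neighbour-of-type connected x y tx≢ty
    with connected (typ x) (typ y) tx≢ty x y (inj₁ refl) (inj₂ refl)
  ... | [] _ = ⊥-elim (tx≢ty refl)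
  ... | _∷_ _ (x*w , tx≢tw) walk with walk-head walk
  ...   | inj₁ tw≡tx = ⊥-elim (tx≢tw (sym tw≡tx))
  ...   | inj₂ tw≡ty = _ , x*w , tw≡ty

  ActsNontriviallyOn : (Permutation′ n → Set) → Fin k → Set
  ActsNontriviallyOn K l = ∃ λ y → typ y ≡ l × ∃ λ h → K h × h ⟨$⟩ʳ y ≢ y

  fixed-by-trivial : ∀ {K x h} → ¬ ActsNontriviallyOn K (typ x) → K h → h ⟨$⟩ʳ x ≡ x
  fixed-by-trivial ¬nontrivial Kh =
    decidable-stable (_ ≟ _) λ hx≢x → ¬nontrivial (_ , refl , _ , Kh , hx≢x)

  incident-to-orbit : (K : Permutation′ n → Set) → (∀ {h} → K h → IsAut Γ h) →
                      ∀ {x y w} → (∀ {h} → K h → h ⟨$⟩ʳ x ≡ x) → TransitiveOn Γ K (typ y) →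
                      x * w → typ w ≡ typ y → x * y
  incident-to-orbit K K⊆Aut {x} {y} {w} K-fixes-x K-transitive x*w tw≡ty
    with K-transitive w y tw≡ty refl
  ... | h , Kh , hw≡y =
    subst₂ _*_ (K-fixes-x Kh) hw≡y (Equivalence.to (proj₂ (K⊆Aut Kh) x w) x*w)

  module _ (G : Permutation′ n → Set) (G≤Aut : SubgroupOfAut Γ G) where
    open SubgroupOfAut G≤Aut

    conjugate : Permutation′ n → Permutation′ n → Permutation′ n
    conjugate c h = flip c ∘ₚ (h ∘ₚ c)

    conjugate-⟨$⟩ʳ : ∀ c h x → conjugate c h ⟨$⟩ʳ (c ⟨$⟩ʳ x) ≡ c ⟨$⟩ʳ (h ⟨$⟩ʳ x)
    conjugate-⟨$⟩ʳ c h x = cong (λ z → c ⟨$⟩ʳ (h ⟨$⟩ʳ z)) (inverseˡ c)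

    record IsNormalSubgroup (K : Permutation′ n → Set) : Set where
      field
        ⊆G            : ∀ {h} → K h → G h
        has-id        : K id
        has-∘         : ∀ {g h} → K g → K h → K (g ∘ₚ h)
        has-inv       : ∀ {h} → K h → K (flip h)
        has-conjugate : ∀ {c h} → G c → K h → K (conjugate c h)

    Orbit : (Permutation′ n → Set) → Fin n → Fin n → Set
    Orbit K y z = Σ (Permutation′ n) λ h → K h × h ⟨$⟩ʳ y ≡ z

    module _ {K : Permutation′ n → Set} (K⊴G : IsNormalSubgroup K) where
      open IsNormalSubgroup K⊴G renaming (has-id to K-id; has-∘ to K-∘; has-inv to K-inv)

      orbit-refl : ∀ y → Orbit K y y
      orbit-refl y = id , K-id , refl

      orbit-sym : ∀ {y z} → Orbit K y z → Orbit K z y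
      orbit-sym (h , Kh , hy≡z) =
        flip h , K-inv Kh , trans (cong (h ⟨$⟩ˡ_) (sym hy≡z)) (inverseˡ h)

      orbit-trans : ∀ {x y z} → Orbit K x y → Orbit K y z → Orbit K x z
      orbit-trans (g , Kg , gx≡y) (h , Kh , hy≡z) =
        g ∘ₚ h , K-∘ Kg Kh , trans (cong (h ⟨$⟩ʳ_) gx≡y) hy≡z

      orbit-conjugate : ∀ {c y z} → G c → Orbit K y z → Orbit K (c ⟨$⟩ʳ y) (c ⟨$⟩ʳ z)
      orbit-conjugate {c} {y} Gc (h , Kh , hy≡z) =
        conjugate c h , has-conjugate Gc Kh , trans (conjugate-⟨$⟩ʳ c h y) (cong (c ⟨$⟩ʳ_) hy≡z)

      orbit-type : ∀ {y z} → Orbit K y z → typ z ≡ typ y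
      orbit-type (h , Kh , hy≡z) = trans (cong typ (sym hy≡z)) (proj₁ (aut (⊆G Kh)) _)

      orbit-isBlock : ∀ {y} (Orbit? : Decidable (Orbit K y)) → IsBlock Γ G (typ y) (toSubset Orbit?)
      orbit-isBlock {y} Orbit? = (λ z → orbit-type ∘ ∈-toSubset⁻ Orbit?) , block
        where
        block : ∀ c → G c → (∀ z → z ∈ toSubset Orbit? → c ⟨$⟩ʳ z ∈ toSubset Orbit?)
                          ⊎ (∀ z → z ∈ toSubset Orbit? → c ⟨$⟩ʳ z ∉ toSubset Orbit?)
        block c Gc with Orbit? (c ⟨$⟩ʳ y)
        ... | yes y~cy = inj₁ λ z z∈B →
          ∈-toSubset⁺ Orbit? (orbit-trans y~cy (orbit-conjugate Gc (∈-toSubset⁻ Orbit? z∈B)))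
        ... | no  y≁cy = inj₂ λ z z∈B cz∈B → y≁cy
          (orbit-trans (∈-toSubset⁻ Orbit? cz∈B)
            (orbit-sym (orbit-conjugate Gc (∈-toSubset⁻ Orbit? z∈B))))

      moving⇒transitive : ∀ {y h} → PrimitiveOn Γ G (typ y) → K h → h ⟨$⟩ʳ y ≢ y →
                          ¬ ¬ TransitiveOn Γ K (typ y)
      moving⇒transitive {y} {h} (_ , blocks-trivial) Kh hy≢y =
        ¬¬-map transitive (¬¬-decidable (Orbit K y))
        where
        transitive : Decidable (Orbit K y) → TransitiveOn Γ K (typ y)
        transitive Orbit? with blocks-trivial (toSubset Orbit?) (orbit-isBlock Orbit?)
        ... | inj₁ ∣B∣≤1 = ⊥-elim (<⇒≱ (x≢y⇒1<∣p∣ (∈-toSubset⁺ Orbit? (orbit-refl y))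
                                         (∈-toSubset⁺ Orbit? (h , Kh , refl)) (hy≢y ∘ sym)) ∣B∣≤1)
        ... | inj₂ B-full = λ w z tw ty →
          orbit-trans (orbit-sym (∈-toSubset⁻ Orbit? (B-full w tw))) (∈-toSubset⁻ Orbit? (B-full z ty))

      module _ (connected : Rank2Connected Γ) (fully-primitive : FullyPrimitive Γ G) where

        trivial-nontrivial⇒incident : ∀ x y → typ x ≢ typ y → ¬ ActsNontriviallyOn K (typ x) →
                                      ¬ ¬ ActsNontriviallyOn K (typ y) → x * y
        trivial-nontrivial⇒incident x y tx≢ty trivial-x ¬¬nontrivial-y
          with neighbour-of-type connected x y tx≢ty
        ... | _ , x*w , tw≡ty =
          decidable-stable (*-dec x y) λ ¬x*y → ¬¬nontrivial-y λ (y′ , ty′≡ty , h , Kh , hy′≢y′) →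
            moving⇒transitive (fully-primitive (typ y′)) Kh hy′≢y′ λ K-transitive →
              ¬x*y (incident-to-orbit K (aut ∘ ⊆G) (fixed-by-trivial trivial-x)
                      (subst (TransitiveOn Γ K) ty′≡ty K-transitive) x*w tw≡ty)

        trivial-nontrivial⇒decomposable : ∀ {i j} → ¬ ActsNontriviallyOn K i →
                                          ActsNontriviallyOn K j → ¬ ¬ Decomposable Γ
        trivial-nontrivial⇒decomposable {i} {j} trivial-i nontrivial-j =
          ¬¬-map decomposition (¬¬-decidable (ActsNontriviallyOn K))
          where
          decomposition : Decidable (ActsNontriviallyOn K) → Decomposable Γ
          decomposition Nontrivial? =
              I₁
            , (i , ∈-toSubset⁺ Trivial? trivial-i)
            , (j , λ j∈I₁ → ∈-toSubset⁻ Trivial? j∈I₁ nontrivial-j)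
            , λ x y tx∈I₁ ty∉I₁ → trivial-nontrivial⇒incident x y
                (λ tx≡ty → ty∉I₁ (subst (_∈ I₁) tx≡ty tx∈I₁))
                (∈-toSubset⁻ Trivial? tx∈I₁) (ty∉I₁ ∘ ∈-toSubset⁺ Trivial?)
            where
            Trivial? : Decidable (¬_ ∘ ActsNontriviallyOn K)
            Trivial? = ¬? ∘ Nontrivial?
            I₁ : Subset k
            I₁ = toSubset Trivial?

    Kernel : Fin k → Permutation′ n → Set
    Kernel i h = G h × (∀ x → typ x ≡ i → h ⟨$⟩ʳ x ≡ x)

    kernel-isNormalSubgroup : ∀ i → IsNormalSubgroup (Kernel i)
    kernel-isNormalSubgroup i = record
      { ⊆G            = proj₁
      ; has-id        = has-id , λ _ _ → refl
      ; has-∘         = λ { {g} {h} (Gg , g-fix) (Gh , h-fix) →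
                          has-∘ Gg Gh , λ x tx → trans (cong (h ⟨$⟩ʳ_) (g-fix x tx)) (h-fix x tx) }
      ; has-inv       = λ { {h} (Gh , h-fix) →
                          has-inv Gh , λ x tx → trans (cong (h ⟨$⟩ˡ_) (sym (h-fix x tx))) (inverseˡ h) }
      ; has-conjugate = λ { {c} {h} Gc (Gh , h-fix) →
                          has-∘ (has-inv Gc) (has-∘ Gh Gc) , λ x tx →
                            trans (cong (c ⟨$⟩ʳ_) (h-fix _ (trans (proj₁ (aut (has-inv Gc)) x) tx)))
                                  (inverseʳ c) }
      }

    kernel-acts-trivially : ∀ i → ¬ ActsNontriviallyOn (Kernel i) i
    kernel-acts-trivially i (y , ty , h , (_ , h-fix) , hy≢y) = hy≢y (h-fix y ty)

lemma3p2 : ∀ {n k : ℕ} (Γ : Pregeometry n k) (G : Permutation′ n → Set) →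
    Rank2Connected Γ →
    SubgroupOfAut Γ G →
    (∀ (i : Fin k) → TransitiveOn Γ G i) →
    FullyPrimitive Γ G →
    Indecomposable Γ →
    FullyFaithful Γ G
-- Transitivity on each X_i is already part of full primitivity.
lemma3p2 Γ G connected G≤Aut _ fully-primitive indecomposable i g Gg g-fix x =
  decidable-stable (g ⟨$⟩ʳ x ≟ x) λ gx≢x →
    trivial-nontrivial⇒decomposable Γ G G≤Aut (kernel-isNormalSubgroup Γ G G≤Aut i)
      connected fully-primitive (kernel-acts-trivially Γ G G≤Aut i)
      (x , refl , g , (Gg , g-fix) , gx≢x) indecomposable
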